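{- Let $h \geq 1$ and $\ell \geq 14$ be integers, and let $H$ be a graph on $n$ vertices of maximum degree at most $h$ such that at most $\frac{1}{60}\cdot n$ vertices of $H$ have degree less than $\ell$. Then there are at most $h^2 \cdot 2^n \cdot e^{ -\frac{n}{1800h^4}}$ subsets $S$ of $V(H)$ such that $|L(S)| \geq \frac{1}{20}\cdot n$.
   Context: All graphs are finite and simple. For $S \subseteq V(H)$ and a vertex $v$, $d_S(v)$ denotes the number of vertices of $S$ adjacent to $v$ in $H$. The set $L(S) = \{v \in V(H) : d_S(v) \leq 2\}$ is the set of vertices of low $S$-degree. -}

module Defs where

open import Data.Bool using (Bool; true; false)
open import Data.Nat using (ℕ; zero; suc; _+_; _*_; _^_; _≤ᵇ_; _<ᵇ_; _≤_; _!)
open import Data.Fin using (Fin)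
open import Data.Fin.Subset using (Subset; _∩_; ∣_∣)
open import Data.Vec using (Vec; []; _∷_; tabulate)
open import Data.List using (List; []; _∷_; map; _++_; length; filterᵇ)
open import Relation.Binary.PropositionalEquality using (_≡_)

record Graph (n : ℕ) : Set where
  field
    adj    : Fin n → Fin n → Bool
    sym    : ∀ u v → adj u v ≡ adj v u
    irrefl : ∀ v → adj v v ≡ false
open Graph public

N : ∀ {n} → Graph n → Fin n → Subset n
N H v = tabulate (adj H v)

deg : ∀ {n} → Graph n → Fin n → ℕ
deg H v = ∣ N H v ∣

dS : ∀ {n} → Graph n → Subset n → Fin n → ℕ
dS H S v = ∣ S ∩ N H v ∣

L : ∀ {n} → Graph n → Subset n → Subset n
L H S = tabulate (λ v → dS H S v ≤ᵇ 2)

lowDegCount : ∀ {n} → Graph n → ℕ → ℕ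
lowDegCount H ℓ = ∣ tabulate (λ v → deg H v <ᵇ ℓ) ∣

allSubsets : (n : ℕ) → List (Subset n)
allSubsets zero = [] ∷ []
allSubsets (suc n) = map (true ∷_) (allSubsets n) ++ map (false ∷_) (allSubsets n)

bigLCount : ∀ {n} → Graph n → ℕ
bigLCount {n} H = length (filterᵇ (λ S → n ≤ᵇ 20 * ∣ L H S ∣) (allSubsets n))

-- expNum x k = k! · Σ_{j=0}^{k} x^j / j!   (k!-scaled partial sum of e^x)
expNum : ℕ → ℕ → ℕ
expNum x zero = 1
expNum x (suc k) = suc k * expNum x k + x ^ suc k

-- For naturals a, b: "a · e^x ≤ b" (real inequality), expressed via partial sums,
-- which increase to e^x:  a · Σ_{j≤k} x^j/j! ≤ b for all k.
_·e^_≤_ : ℕ → ℕ → ℕ → Set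
a ·e^ x ≤ b = ∀ k → a * expNum x k ≤ b * (k !)

-- Call u marked in S if deg u ≥ ℓ and u ∈ L(S). Since at most n/60 vertices have degree < ℓ,
-- every S with |L(S)| ≥ n/20 has at least n/30 marked vertices. With M = 4h² we bound the
-- exponential moment Σ_S ∏_u (M + [u marked in S]) by peeling off one vertex v at a time: a
-- vertex of degree d ≥ 14 lies in L(S) for at most a 106/2^14 fraction of all S, and resampling
-- S on N(v) changes the remaining factors by at most (1 + 1/M)^(h²), because at most h² of them
-- depend on S ∩ N(v). Markov's inequality then bounds the number of such S by
-- 2^n ((M/(M+1))^(1/30) (1 + 1/(60M)))^n ≤ 2^n 3^(−n/(1800h⁴)), and e ≤ 3.

module Submission where

open import Data.Bool using (Bool; true; false; _∧_; not; T)
open import Data.Bool.Properties using (∧-zeroʳ)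
open import Data.Nat
open import Data.Nat.Properties
open import Data.Nat.DivMod
open import Data.Nat.Tactic.RingSolver using (solve-∀)
open import Data.Nat.ListAction using () renaming (sum to sumˡ)
open import Data.Nat.ListAction.Properties using () renaming (sum-++ to sumˡ-++)
open import Data.Fin using (Fin; zero; suc)
open import Data.Fin.Subset using (Subset; _∩_; ∣_∣)
open import Data.Vec using ([]; _∷_; tabulate; lookup)
open import Data.Vec.Properties using (lookup∘tabulate)
open import Data.List using (List; []; _∷_; map; _++_; length; filterᵇ)
open import Data.List.Properties using (map-++; map-∘)
open import Function using (_∘_; id)
open import Algebra.Properties.Semiring.Sum +-*-semiring using (sum; sum-cong-≗; *-distribˡ-sum)
open import Algebra.Properties.CommutativeSemigroup +-commutativeSemigroup using () renaming (interchange to +-interchange)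
open import Relation.Binary.PropositionalEquality
open import Defs hiding (sym)

^-distribʳ-* : ∀ m n o → (m * n) ^ o ≡ m ^ o * n ^ o
^-distribʳ-* m n zero    = refl
^-distribʳ-* m n (suc o) = trans (cong (m * n *_) (^-distribʳ-* m n o)) (swap m n (m ^ o) (n ^ o))
  where
  swap : ∀ m n a b → m * n * (a * b) ≡ m * a * (n * b)
  swap = solve-∀

bernoulli : ∀ a k → a ^ suc k + suc k * a ^ k ≤ suc a ^ suc k
bernoulli a zero    = ≤-reflexive (base a)
  where
  base : ∀ a → a * 1 + 1 * 1 ≡ suc a * 1
  base = solve-∀
bernoulli a (suc k) = begin
  a ^ suc (suc k) + suc (suc k) * a ^ suc k          ≤⟨ m≤m+n _ (suc k * a ^ k) ⟩
  a ^ suc (suc k) + suc (suc k) * a ^ suc k + suc k * a ^ k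
                                                     ≡⟨ expand a k (a ^ k) ⟩
  suc a * (a ^ suc k + suc k * a ^ k)                ≤⟨ *-monoʳ-≤ (suc a) (bernoulli a k) ⟩
  suc a ^ suc (suc k)                                ∎
  where
  open ≤-Reasoning
  expand : ∀ a k p → a * (a * p) + suc (suc k) * (a * p) + suc k * p ≡ suc a * (a * p + suc k * p)
  expand = solve-∀

^-split : ∀ b {k c} → k ≤ c → b ^ c ≡ b ^ k * b ^ (c ∸ k)
^-split b {k} k≤c = trans (cong (b ^_) (sym (m+[n∸m]≡n k≤c))) (^-distribˡ-+-* b k _)

^-exponent-raise : ∀ {m p k c} x y → m ≤ p → k ≤ c → m ^ k * x ≤ p ^ k * y → m ^ c * x ≤ p ^ c * y
^-exponent-raise {m} {p} {k} {c} x y m≤p k≤c le = begin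
  m ^ c * x                  ≡⟨ regroup m x ⟩
  m ^ (c ∸ k) * (m ^ k * x)  ≤⟨ *-mono-≤ (^-monoˡ-≤ (c ∸ k) m≤p) le ⟩
  p ^ (c ∸ k) * (p ^ k * y)  ≡⟨ regroup p y ⟨
  p ^ c * y                  ∎
  where
  open ≤-Reasoning
  regroup : ∀ b z → b ^ c * z ≡ b ^ (c ∸ k) * (b ^ k * z)
  regroup b z = trans (cong (_* z) (trans (^-split b k≤c) (*-comm (b ^ k) _))) (*-assoc (b ^ (c ∸ k)) (b ^ k) z)

^-exponent-lower : ∀ {m p d e} x y → .{{NonZero m}} → m ≤ p → d ≤ e →
                   p ^ e * x ≤ m ^ e * y → p ^ d * x ≤ m ^ d * y
^-exponent-lower {m} {p} {d} {e} x y m≤p d≤e le =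
  *-cancelˡ-≤ (m ^ (e ∸ d)) {{m^n≢0 m (e ∸ d)}} (begin
    m ^ (e ∸ d) * (p ^ d * x)  ≤⟨ *-monoˡ-≤ (p ^ d * x) (^-monoˡ-≤ (e ∸ d) m≤p) ⟩
    p ^ (e ∸ d) * (p ^ d * x)  ≡⟨ regroup p x ⟨
    p ^ e * x                  ≤⟨ le ⟩
    m ^ e * y                  ≡⟨ regroup m y ⟩
    m ^ (e ∸ d) * (m ^ d * y)  ∎)
  where
  open ≤-Reasoning
  regroup : ∀ b z → b ^ e * z ≡ b ^ (e ∸ d) * (b ^ d * z)
  regroup b z = trans (cong (_* z) (trans (^-split b d≤e) (*-comm (b ^ d) _))) (*-assoc (b ^ (e ∸ d)) (b ^ d) z)

-- With ρ = U/V the hypotheses read x · ρ^n ≤ y and r ≤ ρ^j.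
^-ratio-transfer : ∀ {x y r U V} n j → .{{NonZero V}} →
                   x * U ^ n ≤ y * V ^ n → r * V ^ j ≤ U ^ j → x ^ j * r ^ n ≤ y ^ j
^-ratio-transfer {x} {y} {r} {U} {V} n j xU≤yV rV≤U =
  *-cancelˡ-≤ (V ^ (j * n)) {{m^n≢0 V (j * n)}} (begin
    V ^ (j * n) * (x ^ j * r ^ n)  ≡⟨ lhs ⟩
    x ^ j * (r * V ^ j) ^ n        ≤⟨ *-monoʳ-≤ (x ^ j) (^-monoˡ-≤ n rV≤U) ⟩
    x ^ j * (U ^ j) ^ n            ≡⟨ rhs ⟩
    (x * U ^ n) ^ j                ≤⟨ ^-monoˡ-≤ j xU≤yV ⟩
    (y * V ^ n) ^ j                ≡⟨ ^-distribʳ-* y (V ^ n) j ⟩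
    y ^ j * (V ^ n) ^ j            ≡⟨ cong (y ^ j *_) (^-*-assoc V n j) ⟩
    y ^ j * V ^ (n * j)            ≡⟨ trans (*-comm (y ^ j) _) (cong (λ e → V ^ e * y ^ j) (*-comm n j)) ⟩
    V ^ (j * n) * y ^ j            ∎)
  where
  open ≤-Reasoning
  swap : ∀ a b c → a * (b * c) ≡ b * (c * a)
  swap = solve-∀
  lhs : V ^ (j * n) * (x ^ j * r ^ n) ≡ x ^ j * (r * V ^ j) ^ n
  lhs = begin-equality
    V ^ (j * n) * (x ^ j * r ^ n)  ≡⟨ swap (V ^ (j * n)) (x ^ j) (r ^ n) ⟩
    x ^ j * (r ^ n * V ^ (j * n))  ≡⟨ cong (λ z → x ^ j * (r ^ n * z)) (^-*-assoc V j n) ⟨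
    x ^ j * (r ^ n * (V ^ j) ^ n)  ≡⟨ cong (x ^ j *_) (^-distribʳ-* r (V ^ j) n) ⟨
    x ^ j * (r * V ^ j) ^ n        ∎
  rhs : x ^ j * (U ^ j) ^ n ≡ (x * U ^ n) ^ j
  rhs = begin-equality
    x ^ j * (U ^ j) ^ n  ≡⟨ cong (x ^ j *_) (trans (^-*-assoc U j n) (cong (U ^_) (*-comm j n))) ⟩
    x ^ j * U ^ (n * j)  ≡⟨ cong (x ^ j *_) (^-*-assoc U n j) ⟨
    x ^ j * (U ^ n) ^ j  ≡⟨ ^-distribʳ-* x (U ^ n) j ⟨
    (x * U ^ n) ^ j      ∎

twice-^≤suc-^ : ∀ q .{{_ : NonZero q}} → 2 * q ^ q ≤ suc q ^ q
twice-^≤suc-^ (suc p) = ≤-trans (≤-reflexive (cong (q^q +_) (+-identityʳ q^q))) (bernoulli (suc p) p)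
  where q^q = suc p ^ suc p

thrice-^≤suc-^ : ∀ q .{{_ : NonZero q}} {j} → 2 * q ≤ j → 3 * q ^ j ≤ suc q ^ j
thrice-^≤suc-^ q {j} 2q≤j = subst₂ _≤_ (*-comm (q ^ j) 3) (*-identityʳ (suc q ^ j))
  (^-exponent-raise 3 1 (n≤1+n q) 2q≤j (begin
    q ^ (2 * q) * 3                  ≤⟨ *-monoʳ-≤ (q ^ (2 * q)) (n≤1+n 3) ⟩
    q ^ (2 * q) * 4                  ≡⟨ trans (cong (_* 4) (two q)) (four (q ^ q)) ⟩
    (2 * q ^ q) * (2 * q ^ q)        ≤⟨ *-mono-≤ (twice-^≤suc-^ q) (twice-^≤suc-^ q) ⟩
    suc q ^ q * suc q ^ q            ≡⟨ trans (sym (two (suc q))) (sym (*-identityʳ _)) ⟩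
    suc q ^ (2 * q) * 1              ∎))
  where
  open ≤-Reasoning
  two : ∀ b → b ^ (2 * q) ≡ b ^ q * b ^ q
  two b = trans (cong (b ^_) (cong (q +_) (+-identityʳ q))) (^-distribˡ-+-* b q q)
  four : ∀ a → a * a * 4 ≡ (2 * a) * (2 * a)
  four = solve-∀

-- (1 + 1/z)^c ≤ z / (z − c), for z = c + d.
reverse-bernoulli : ∀ c d {z} → c + d ≡ z → suc z ^ c * d ≤ z * z ^ c
reverse-bernoulli zero    d refl = ≤-reflexive (trans (*-identityˡ d) (sym (*-identityʳ d)))
reverse-bernoulli (suc c) d refl = *-cancelʳ-≤ _ _ (suc d) (begin
  suc z ^ suc c * d * suc d          ≡⟨ regroup (suc z) (suc z ^ c) d ⟩
  (suc z ^ c * suc d) * (suc z * d)  ≤⟨ *-monoˡ-≤ (suc z * d) (reverse-bernoulli c (suc d) (+-suc c d)) ⟩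
  z ^ suc c * (suc z * d)            ≤⟨ *-monoʳ-≤ (z ^ suc c) shift ⟩
  z ^ suc c * (z * suc d)            ≡⟨ regroup′ z (z ^ suc c) (suc d) ⟩
  z ^ suc (suc c) * suc d            ∎)
  where
  open ≤-Reasoning
  z = suc c + d
  shift : suc z * d ≤ z * suc d
  shift = subst (suc z * d ≤_) (sym (*-suc z d)) (+-monoˡ-≤ (z * d) (m≤n+m d (suc c)))
  regroup : ∀ b p d → b * p * d * suc d ≡ (p * suc d) * (b * d)
  regroup = solve-∀
  regroup′ : ∀ z p s → p * (z * s) ≡ z * p * s
  regroup′ = solve-∀

ratio-power : ∀ {q U V r} j → .{{_ : NonZero q}} → r * q ^ j ≤ suc q ^ j → suc q * V ≤ q * U → r * V ^ j ≤ U ^ j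
ratio-power {q} {U} {V} {r} j rq^j≤[1+q]^j [1+q]V≤qU = *-cancelˡ-≤ (q ^ j) {{m^n≢0 q j}} (begin
  q ^ j * (r * V ^ j)  ≡⟨ regroup (q ^ j) r (V ^ j) ⟩
  r * q ^ j * V ^ j    ≤⟨ *-monoˡ-≤ (V ^ j) rq^j≤[1+q]^j ⟩
  suc q ^ j * V ^ j    ≡⟨ ^-distribʳ-* (suc q) V j ⟨
  (suc q * V) ^ j      ≤⟨ ^-monoˡ-≤ j [1+q]V≤qU ⟩
  (q * U) ^ j          ≡⟨ ^-distribʳ-* q U j ⟩
  q ^ j * U ^ j        ∎)
  where
  open ≤-Reasoning
  regroup : ∀ a r v → a * (r * v) ≡ r * a * v
  regroup = solve-∀

-- Partial sums of the exponential series

-- The trapezoid rule for the convex function t ↦ t ^ (k + 1) on [a, a + 1].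
trapezoid : ∀ a k → 2 * suc a ^ suc k ≤ 2 * a ^ suc k + suc k * (a ^ k + suc a ^ k)
trapezoid a zero    = ≤-reflexive (base a)
  where
  base : ∀ a → 2 * (suc a * 1) ≡ 2 * (a * 1) + 1 * (1 + 1)
  base = solve-∀
trapezoid a (suc k) = begin
  2 * suc a ^ suc (suc k)                                ≡⟨ reassoc (suc a) (suc a ^ suc k) ⟩
  suc a * (2 * suc a ^ suc k)                            ≤⟨ *-monoʳ-≤ (suc a) (trapezoid a k) ⟩
  suc a * (2 * a ^ suc k + suc k * (a ^ k + suc a ^ k))  ≤⟨ +-cancelʳ-≤ (suc a ^ suc k) _ _ shifted ⟩
  rhs                                                    ∎
  where
  open ≤-Reasoning
  rhs = 2 * a ^ suc (suc k) + suc (suc k) * (a ^ suc k + suc a ^ suc k)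
  reassoc : ∀ b p → 2 * (b * p) ≡ b * (2 * p)
  reassoc = solve-∀
  expand : ∀ a k p q → suc a * (2 * (a * p) + suc k * (p + q)) + suc a * q
                     ≡ (2 * (a * (a * p)) + suc (suc k) * (a * p + suc a * q)) + (a * p + suc k * p)
  expand = solve-∀
  shifted : suc a * (2 * a ^ suc k + suc k * (a ^ k + suc a ^ k)) + suc a ^ suc k ≤ rhs + suc a ^ suc k
  shifted = begin
    suc a * (2 * a ^ suc k + suc k * (a ^ k + suc a ^ k)) + suc a ^ suc k  ≡⟨ expand a k (a ^ k) (suc a ^ k) ⟩
    rhs + (a ^ suc k + suc k * a ^ k)                                      ≤⟨ +-monoʳ-≤ rhs (bernoulli a k) ⟩
    rhs + suc a ^ suc k                                                    ∎

-- expNum x k / k! is the partial sum e_k(x) of e^x; the invariant says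
-- e_k(x + 1) + 2 (x + 1)^(k+1)/(k+1)! ≤ 3 e_k(x) + 2 x^(k+1)/(k+1)!.
expNum-suc-invariant : ∀ k x → suc k * expNum (suc x) k + 2 * suc x ^ suc k
                             ≤ 3 * suc k * expNum x k + 2 * x ^ suc k
expNum-suc-invariant zero    x = ≤-reflexive (base x)
  where
  base : ∀ x → 1 * 1 + 2 * (suc x * 1) ≡ 3 * 1 * 1 + 2 * (x * 1)
  base = solve-∀
expNum-suc-invariant (suc k) x = +-cancelʳ-≤ (K * q) _ _ (begin
  K * (suc k * expNum (suc x) k + q) + 2 * suc x ^ suc (suc k) + K * q
      ≡⟨ regroupˡ k (expNum (suc x) k) q x ⟩
  K * (suc k * expNum (suc x) k + 2 * q) + 2 * (suc x * q)
      ≤⟨ +-mono-≤ (*-monoʳ-≤ K (expNum-suc-invariant k x)) (trapezoid x (suc k)) ⟩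
  K * (3 * suc k * expNum x k + 2 * p) + (2 * (x * p) + K * (p + q))
      ≡⟨ regroupʳ k (expNum x k) p q x ⟩
  3 * K * (suc k * expNum x k + p) + 2 * x ^ suc (suc k) + K * q
      ∎)
  where
  open ≤-Reasoning
  K = suc (suc k)
  p = x ^ suc k
  q = suc x ^ suc k
  regroupˡ : ∀ k g q x → suc (suc k) * (suc k * g + q) + 2 * (suc x * q) + suc (suc k) * q
                       ≡ suc (suc k) * (suc k * g + 2 * q) + 2 * (suc x * q)
  regroupˡ = solve-∀
  regroupʳ : ∀ k g p q x → suc (suc k) * (3 * suc k * g + 2 * p) + (2 * (x * p) + suc (suc k) * (p + q))
                         ≡ 3 * suc (suc k) * (suc k * g + p) + 2 * (x * p) + suc (suc k) * q
  regroupʳ = solve-∀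

expNum-suc≤3*expNum : ∀ x k → expNum (suc x) k ≤ 3 * expNum x k
expNum-suc≤3*expNum x k = *-cancelˡ-≤ (suc k) (+-cancelʳ-≤ (2 * x ^ suc k) _ _ (begin
  suc k * expNum (suc x) k + 2 * x ^ suc k      ≤⟨ +-monoʳ-≤ (suc k * expNum (suc x) k) (*-monoʳ-≤ 2 (^-monoˡ-≤ (suc k) (n≤1+n x))) ⟩
  suc k * expNum (suc x) k + 2 * suc x ^ suc k  ≤⟨ expNum-suc-invariant k x ⟩
  3 * suc k * expNum x k + 2 * x ^ suc k        ≡⟨ cong (_+ 2 * x ^ suc k) (*-comm-middle (suc k) (expNum x k)) ⟩
  suc k * (3 * expNum x k) + 2 * x ^ suc k      ∎))
  where
  open ≤-Reasoning
  *-comm-middle : ∀ k g → 3 * k * g ≡ k * (3 * g)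
  *-comm-middle = solve-∀

expNum-zero : ∀ k → expNum 0 k ≡ k !
expNum-zero zero    = refl
expNum-zero (suc k) = trans (+-identityʳ _) (cong (suc k *_) (expNum-zero k))

expNum≤3^*! : ∀ x k → expNum x k ≤ 3 ^ x * k !
expNum≤3^*! zero    k = ≤-reflexive (trans (expNum-zero k) (sym (+-identityʳ _)))
expNum≤3^*! (suc x) k = begin
  expNum (suc x) k     ≤⟨ expNum-suc≤3*expNum x k ⟩
  3 * expNum x k       ≤⟨ *-monoʳ-≤ 3 (expNum≤3^*! x k) ⟩
  3 * (3 ^ x * k !)    ≡⟨ *-assoc 3 (3 ^ x) (k !) ⟨
  3 ^ suc x * k !      ∎
  where open ≤-Reasoning

·e^≤-from-3^ : ∀ a x b → a * 3 ^ x ≤ b → a ·e^ x ≤ b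
·e^≤-from-3^ a x b a3^x≤b k = begin
  a * expNum x k       ≤⟨ *-monoʳ-≤ a (expNum≤3^*! x k) ⟩
  a * (3 ^ x * k !)    ≡⟨ *-assoc a (3 ^ x) (k !) ⟨
  a * 3 ^ x * k !      ≤⟨ *-monoˡ-≤ (k !) a3^x≤b ⟩
  b * k !              ∎
  where open ≤-Reasoning

sum-mono-≤ : ∀ {m} {f g : Fin m → ℕ} → (∀ i → f i ≤ g i) → sum f ≤ sum g
sum-mono-≤ {zero}  f≤g = z≤n
sum-mono-≤ {suc m} f≤g = +-mono-≤ (f≤g zero) (sum-mono-≤ (f≤g ∘ suc))

sum-distrib-+ : ∀ {m} (f g : Fin m → ℕ) → sum (λ i → f i + g i) ≡ sum f + sum g
sum-distrib-+ {zero}  f g = refl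
sum-distrib-+ {suc m} f g = trans (cong (f zero + g zero +_) (sum-distrib-+ (f ∘ suc) (g ∘ suc)))
                                  (+-interchange (f zero) (g zero) _ _)

sum-zero : ∀ m → sum {m} (λ _ → 0) ≡ 0
sum-zero zero    = refl
sum-zero (suc m) = sum-zero m

sum-comm : ∀ {m k} (f : Fin m → Fin k → ℕ) → sum (λ i → sum (f i)) ≡ sum (λ j → sum (λ i → f i j))
sum-comm {zero}  {k} f = sym (sum-zero k)
sum-comm {suc m} f = trans (cong (sum (f zero) +_) (sum-comm (f ∘ suc)))
                           (sym (sum-distrib-+ (f zero) (λ j → sum (λ i → f (suc i) j))))

iverson : Bool → ℕ
iverson true  = 1
iverson false = 0

iverson≤1 : ∀ b → iverson b ≤ 1
iverson≤1 true  = ≤-refl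
iverson≤1 false = z≤n

iverson-∧ : ∀ a b → iverson (a ∧ b) ≡ iverson a * iverson b
iverson-∧ true  b = sym (+-identityʳ _)
iverson-∧ false b = refl

∣x∷p∣≡iverson[x]+∣p∣ : ∀ {n} x (p : Subset n) → ∣ x ∷ p ∣ ≡ iverson x + ∣ p ∣
∣x∷p∣≡iverson[x]+∣p∣ true  p = refl
∣x∷p∣≡iverson[x]+∣p∣ false p = refl

∣tabulate∣≡sum : ∀ {n} (f : Fin n → Bool) → ∣ tabulate f ∣ ≡ sum (iverson ∘ f)
∣tabulate∣≡sum {zero}  f = refl
∣tabulate∣≡sum {suc n} f = trans (∣x∷p∣≡iverson[x]+∣p∣ (f zero) (tabulate (f ∘ suc))) (cong (iverson (f zero) +_) (∣tabulate∣≡sum (f ∘ suc)))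

∣p∩q∣≡sum : ∀ {n} (p q : Subset n) → ∣ p ∩ q ∣ ≡ sum (λ i → iverson (lookup p i ∧ lookup q i))
∣p∩q∣≡sum []      []      = refl
∣p∩q∣≡sum (x ∷ p) (y ∷ q) = trans (∣x∷p∣≡iverson[x]+∣p∣ (x ∧ y) (p ∩ q)) (cong (iverson (x ∧ y) +_) (∣p∩q∣≡sum p q))

sumSubsets : ∀ n → (Subset n → ℕ) → ℕ
sumSubsets zero    f = f []
sumSubsets (suc n) f = sumSubsets n (f ∘ (true ∷_)) + sumSubsets n (f ∘ (false ∷_))

syntax sumSubsets n (λ S → e) = ∑[ S ⊆ n ] e

sumSubsets-cong : ∀ n {f g : Subset n → ℕ} → (∀ S → f S ≡ g S) → sumSubsets n f ≡ sumSubsets n g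
sumSubsets-cong zero    f≡g = f≡g []
sumSubsets-cong (suc n) f≡g = cong₂ _+_ (sumSubsets-cong n (f≡g ∘ (true ∷_))) (sumSubsets-cong n (f≡g ∘ (false ∷_)))

sumSubsets-mono-≤ : ∀ n {f g : Subset n → ℕ} → (∀ S → f S ≤ g S) → sumSubsets n f ≤ sumSubsets n g
sumSubsets-mono-≤ zero    f≤g = f≤g []
sumSubsets-mono-≤ (suc n) f≤g = +-mono-≤ (sumSubsets-mono-≤ n (f≤g ∘ (true ∷_))) (sumSubsets-mono-≤ n (f≤g ∘ (false ∷_)))

sumSubsets-distrib-+ : ∀ n (f g : Subset n → ℕ) → ∑[ S ⊆ n ] (f S + g S) ≡ sumSubsets n f + sumSubsets n g
sumSubsets-distrib-+ zero    f g = refl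
sumSubsets-distrib-+ (suc n) f g =
  trans (cong₂ _+_ (sumSubsets-distrib-+ n (f ∘ (true ∷_)) (g ∘ (true ∷_)))
                   (sumSubsets-distrib-+ n (f ∘ (false ∷_)) (g ∘ (false ∷_))))
        (+-interchange (sumSubsets n (f ∘ (true ∷_))) (sumSubsets n (g ∘ (true ∷_)))
                       (sumSubsets n (f ∘ (false ∷_))) (sumSubsets n (g ∘ (false ∷_))))

*-distribˡ-sumSubsets : ∀ n c (f : Subset n → ℕ) → ∑[ S ⊆ n ] (c * f S) ≡ c * sumSubsets n f
*-distribˡ-sumSubsets zero    c f = refl
*-distribˡ-sumSubsets (suc n) c f =
  trans (cong₂ _+_ (*-distribˡ-sumSubsets n c _) (*-distribˡ-sumSubsets n c _)) (sym (*-distribˡ-+ c _ _))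

sumSubsets-const : ∀ n c → ∑[ S ⊆ n ] c ≡ 2 ^ n * c
sumSubsets-const zero    c = sym (+-identityʳ c)
sumSubsets-const (suc n) c = trans (cong₂ _+_ (sumSubsets-const n c) (sumSubsets-const n c)) (double (2 ^ n) c)
  where
  double : ∀ a c → a * c + a * c ≡ 2 * a * c
  double = solve-∀

sumˡ-allSubsets : ∀ n (f : Subset n → ℕ) → sumˡ (map f (allSubsets n)) ≡ sumSubsets n f
sumˡ-allSubsets zero    f = +-identityʳ (f [])
sumˡ-allSubsets (suc n) f = begin
  sumˡ (map f (map (true ∷_) A ++ map (false ∷_) A))
    ≡⟨ cong sumˡ (map-++ f (map (true ∷_) A) _) ⟩
  sumˡ (map f (map (true ∷_) A) ++ map f (map (false ∷_) A))
    ≡⟨ sumˡ-++ (map f (map (true ∷_) A)) _ ⟩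
  sumˡ (map f (map (true ∷_) A)) + sumˡ (map f (map (false ∷_) A))
    ≡⟨ cong₂ _+_ (half true) (half false) ⟩
  sumSubsets (suc n) f ∎
  where
  open ≡-Reasoning
  A = allSubsets n
  half : ∀ b → sumˡ (map f (map (b ∷_) A)) ≡ sumSubsets n (f ∘ (b ∷_))
  half b = trans (cong sumˡ (sym (map-∘ A))) (sumˡ-allSubsets n (f ∘ (b ∷_)))

-- Resampling a random subset

resample : ∀ {n} → Subset n → Subset n → Subset n → Subset n
resample []          []      []      = []
resample (true ∷ B)  (_ ∷ S) (y ∷ T) = y ∷ resample B S T
resample (false ∷ B) (x ∷ S) (_ ∷ T) = x ∷ resample B S T

resample-∩ : ∀ {n} (B S T : Subset n) → resample B T S ∩ B ≡ S ∩ B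
resample-∩ []          []      []      = refl
resample-∩ (true ∷ B)  (x ∷ S) (y ∷ T) = cong ((x ∧ true) ∷_) (resample-∩ B S T)
resample-∩ (false ∷ B) (x ∷ S) (y ∷ T) = cong₂ _∷_ (trans (∧-zeroʳ y) (sym (∧-zeroʳ x))) (resample-∩ B S T)

resample-disjoint : ∀ {n} (B D S T : Subset n) → ∣ B ∩ D ∣ ≡ 0 → resample B S T ∩ D ≡ S ∩ D
resample-disjoint []          []          []      []      _  = refl
resample-disjoint (true ∷ B)  (true ∷ D)  S       T       ()
resample-disjoint (true ∷ B)  (false ∷ D) (x ∷ S) (y ∷ T) B∩D≡∅ =
  cong₂ _∷_ (trans (∧-zeroʳ y) (sym (∧-zeroʳ x))) (resample-disjoint B D S T B∩D≡∅)
resample-disjoint (false ∷ B) (d ∷ D)     (x ∷ S) (y ∷ T) B∩D≡∅ =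
  cong ((x ∧ d) ∷_) (resample-disjoint B D S T B∩D≡∅)

sumSubsets²-suc : ∀ n (F : Subset (suc n) → Subset (suc n) → ℕ) →
  ∑[ S ⊆ suc n ] ∑[ T ⊆ suc n ] F S T
    ≡ (∑[ S ⊆ n ] ∑[ T ⊆ n ] F (true ∷ S) (true ∷ T) + ∑[ S ⊆ n ] ∑[ T ⊆ n ] F (true ∷ S) (false ∷ T))
    + (∑[ S ⊆ n ] ∑[ T ⊆ n ] F (false ∷ S) (true ∷ T) + ∑[ S ⊆ n ] ∑[ T ⊆ n ] F (false ∷ S) (false ∷ T))
sumSubsets²-suc n F = cong₂ _+_ (sumSubsets-distrib-+ n _ _) (sumSubsets-distrib-+ n _ _)

-- (S, T) ↦ (resample B S T, resample B T S) is a bijection: it exchanges the parts of S and T inside B.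
sumSubsets²-resample : ∀ n (B : Subset n) (G : Subset n → Subset n → ℕ) →
  ∑[ S ⊆ n ] ∑[ T ⊆ n ] G (resample B S T) (resample B T S) ≡ ∑[ S ⊆ n ] ∑[ T ⊆ n ] G S T
sumSubsets²-resample zero    []          G = refl
sumSubsets²-resample (suc n) (true ∷ B)  G =
  trans (sumSubsets²-suc n (λ S T → G (resample (true ∷ B) S T) (resample (true ∷ B) T S)))
  (trans (cong₂ _+_ (cong₂ _+_ (ih true true) (ih false true)) (cong₂ _+_ (ih true false) (ih false false)))
  (trans (+-interchange (E true true) (E false true) (E true false) (E false false))
         (sym (sumSubsets²-suc n G))))
  where
  E : Bool → Bool → ℕ
  E x y = ∑[ S ⊆ n ] ∑[ T ⊆ n ] G (x ∷ S) (y ∷ T)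
  ih : ∀ x y → ∑[ S ⊆ n ] ∑[ T ⊆ n ] G (x ∷ resample B S T) (y ∷ resample B T S) ≡ E x y
  ih x y = sumSubsets²-resample n B (λ S T → G (x ∷ S) (y ∷ T))
sumSubsets²-resample (suc n) (false ∷ B) G =
  trans (sumSubsets²-suc n (λ S T → G (resample (false ∷ B) S T) (resample (false ∷ B) T S)))
  (trans (cong₂ _+_ (cong₂ _+_ (ih true true) (ih true false)) (cong₂ _+_ (ih false true) (ih false false)))
         (sym (sumSubsets²-suc n G)))
  where
  ih : ∀ x y → ∑[ S ⊆ n ] ∑[ T ⊆ n ] G (x ∷ resample B S T) (y ∷ resample B T S)
             ≡ ∑[ S ⊆ n ] ∑[ T ⊆ n ] G (x ∷ S) (y ∷ T)
  ih x y = sumSubsets²-resample n B (λ S T → G (x ∷ S) (y ∷ T))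

decorrelation : ∀ n (B : Subset n) (a b : ℕ) (F g : Subset n → ℕ) →
  (∀ S T → g (resample B T S) ≡ g S) → (∀ S T → a * F S ≤ b * F (resample B S T)) →
  2 ^ n * a * ∑[ S ⊆ n ] (g S * F S) ≤ b * (sumSubsets n g * sumSubsets n F)
decorrelation n B a b F g g-local F-stable = begin
  2 ^ n * a * ∑[ S ⊆ n ] (g S * F S)                                  ≡⟨ lhs ⟩
  ∑[ S ⊆ n ] ∑[ T ⊆ n ] (g S * (a * F S))                            ≤⟨ sumSubsets-mono-≤ n (λ S →
                                                                          sumSubsets-mono-≤ n (λ T → *-monoʳ-≤ (g S) (F-stable S T))) ⟩
  ∑[ S ⊆ n ] ∑[ T ⊆ n ] (g S * (b * F (resample B S T)))             ≡⟨ sumSubsets-cong n (λ S → sumSubsets-cong n (λ T →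
                                                                          cong (_* (b * F (resample B S T))) (g-local S T))) ⟨
  ∑[ S ⊆ n ] ∑[ T ⊆ n ] (g (resample B T S) * (b * F (resample B S T))) ≡⟨ sumSubsets²-resample n B (λ U V → g V * (b * F U)) ⟩
  ∑[ S ⊆ n ] ∑[ T ⊆ n ] (g T * (b * F S))                            ≡⟨ rhs ⟩
  b * (sumSubsets n g * sumSubsets n F)                               ∎
  where
  open ≤-Reasoning
  lhs : 2 ^ n * a * ∑[ S ⊆ n ] (g S * F S) ≡ ∑[ S ⊆ n ] ∑[ T ⊆ n ] (g S * (a * F S))
  lhs = begin-equality
    2 ^ n * a * ∑[ S ⊆ n ] (g S * F S)         ≡⟨ trans (cong (_* ∑[ S ⊆ n ] (g S * F S)) (*-comm (2 ^ n) a)) (*-assoc a (2 ^ n) _) ⟩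
    a * (2 ^ n * ∑[ S ⊆ n ] (g S * F S))       ≡⟨ cong (a *_) (*-distribˡ-sumSubsets n (2 ^ n) _) ⟨
    a * ∑[ S ⊆ n ] (2 ^ n * (g S * F S))       ≡⟨ *-distribˡ-sumSubsets n a _ ⟨
    ∑[ S ⊆ n ] (a * (2 ^ n * (g S * F S)))     ≡⟨ sumSubsets-cong n (λ S →
                                                    trans (cong (a *_) (sym (sumSubsets-const n (g S * F S))))
                                                    (trans (sym (*-distribˡ-sumSubsets n a _))
                                                           (sumSubsets-cong n (λ _ → rearrange a (g S) (F S))))) ⟩
    ∑[ S ⊆ n ] ∑[ T ⊆ n ] (g S * (a * F S))    ∎
    where
    rearrange : ∀ a x y → a * (x * y) ≡ x * (a * y)
    rearrange = solve-∀
  rhs : ∑[ S ⊆ n ] ∑[ T ⊆ n ] (g T * (b * F S)) ≡ b * (sumSubsets n g * sumSubsets n F)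
  rhs = begin-equality
    ∑[ S ⊆ n ] ∑[ T ⊆ n ] (g T * (b * F S))    ≡⟨ sumSubsets-cong n (λ S →
                                                    trans (sumSubsets-cong n (λ T → *-comm (g T) (b * F S)))
                                                          (*-distribˡ-sumSubsets n (b * F S) g)) ⟩
    ∑[ S ⊆ n ] (b * F S * sumSubsets n g)      ≡⟨ sumSubsets-cong n (λ S → rearrange b (F S) (sumSubsets n g)) ⟩
    ∑[ S ⊆ n ] (b * sumSubsets n g * F S)      ≡⟨ *-distribˡ-sumSubsets n (b * sumSubsets n g) F ⟩
    b * sumSubsets n g * sumSubsets n F        ≡⟨ *-assoc b _ _ ⟩
    b * (sumSubsets n g * sumSubsets n F)      ∎
    where
    rearrange : ∀ b x y → b * x * y ≡ b * y * x
    rearrange = solve-∀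

length-filter*≤sum : ∀ {A : Set} (p : A → Bool) (f : A → ℕ) {c} (xs : List A) →
  (∀ x → T (p x) → c ≤ f x) → length (filterᵇ p xs) * c ≤ sumˡ (map f xs)
length-filter*≤sum p f []       _      = z≤n
length-filter*≤sum p f (x ∷ xs) p⇒c≤f with p x in px
... | true  = +-mono-≤ (p⇒c≤f x (subst T (sym px) _)) (length-filter*≤sum p f xs p⇒c≤f)
... | false = ≤-trans (length-filter*≤sum p f xs p⇒c≤f) (m≤n+m _ (f x))

-- The lower tail of the binomial distribution

-- lowCount k c is the number of subsets T of a k-element set with c + ∣ T ∣ ≤ 2.
lowCount : ℕ → ℕ → ℕ
lowCount zero    c = iverson (c ≤ᵇ 2)
lowCount (suc k) c = lowCount k (suc c) + lowCount k c

lowCount-suc≤ : ∀ k c → lowCount k (suc c) ≤ lowCount k c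
lowCount-suc≤ zero    zero                = s≤s z≤n
lowCount-suc≤ zero    (suc zero)          = s≤s z≤n
lowCount-suc≤ zero    (suc (suc zero))    = z≤n
lowCount-suc≤ zero    (suc (suc (suc c))) = z≤n
lowCount-suc≤ (suc k) c = +-mono-≤ (lowCount-suc≤ k (suc c)) (lowCount-suc≤ k c)

-- 106 = 1 + 14 + 91 = lowCount 14 0, and lowCount d 0 / 2^d decreases in d.
lowCount-bound : ∀ {d} → 14 ≤ d → 2 ^ 14 * lowCount d 0 ≤ 106 * 2 ^ d
lowCount-bound {d} 14≤d = subst (λ d → 2 ^ 14 * lowCount d 0 ≤ 106 * 2 ^ d) (m∸n+n≡m 14≤d) (from14 (d ∸ 14))
  where
  open ≤-Reasoning
  double : ∀ a x → a * (x + x) ≡ 2 * (a * x)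
  double = solve-∀
  from14 : ∀ k → 2 ^ 14 * lowCount (k + 14) 0 ≤ 106 * 2 ^ (k + 14)
  from14 zero    = ≤-refl
  from14 (suc k) = begin
    2 ^ 14 * (lowCount (k + 14) 1 + lowCount (k + 14) 0)  ≤⟨ *-monoʳ-≤ (2 ^ 14) (+-monoˡ-≤ _ (lowCount-suc≤ (k + 14) 0)) ⟩
    2 ^ 14 * (lowCount (k + 14) 0 + lowCount (k + 14) 0)  ≡⟨ double (2 ^ 14) (lowCount (k + 14) 0) ⟩
    2 * (2 ^ 14 * lowCount (k + 14) 0)                    ≤⟨ *-monoʳ-≤ 2 (from14 k) ⟩
    2 * (106 * 2 ^ (k + 14))                              ≡⟨ *-comm-middle (2 ^ (k + 14)) ⟩
    106 * 2 ^ suc (k + 14)                                ∎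
    where
    *-comm-middle : ∀ p → 2 * (106 * p) ≡ 106 * (2 * p)
    *-comm-middle = solve-∀

-- ∣ S ∩ B ∣ is binomially distributed with parameters ∣ B ∣ and 1/2.
sumSubsets-lowCount : ∀ n (B : Subset n) c →
  2 ^ ∣ B ∣ * ∑[ S ⊆ n ] iverson (c + ∣ S ∩ B ∣ ≤ᵇ 2) ≡ 2 ^ n * lowCount (∣ B ∣) c
sumSubsets-lowCount zero    []          c = cong (λ z → 1 * iverson (z ≤ᵇ 2)) (+-identityʳ c)
sumSubsets-lowCount (suc n) (true ∷ B)  c = begin
  2 * 2 ^ ∣ B ∣ * (∑[ S ⊆ n ] iverson (c + suc ∣ S ∩ B ∣ ≤ᵇ 2) + ∑[ S ⊆ n ] iverson (c + ∣ S ∩ B ∣ ≤ᵇ 2))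
    ≡⟨ cong (λ z → 2 * 2 ^ ∣ B ∣ * (z + X c)) (sumSubsets-cong n (λ S → cong (λ z → iverson (z ≤ᵇ 2)) (+-suc c ∣ S ∩ B ∣))) ⟩
  2 * 2 ^ ∣ B ∣ * (X (suc c) + X c)                                  ≡⟨ distrib (2 ^ ∣ B ∣) (X (suc c)) (X c) ⟩
  2 * (2 ^ ∣ B ∣ * X (suc c)) + 2 * (2 ^ ∣ B ∣ * X c)               ≡⟨ cong₂ (λ a b → 2 * a + 2 * b) (sumSubsets-lowCount n B (suc c)) (sumSubsets-lowCount n B c) ⟩
  2 * (2 ^ n * lowCount (∣ B ∣) (suc c)) + 2 * (2 ^ n * lowCount (∣ B ∣) c) ≡⟨ distrib (2 ^ n) _ _ ⟨
  2 * 2 ^ n * (lowCount (∣ B ∣) (suc c) + lowCount (∣ B ∣) c)            ∎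
  where
  open ≡-Reasoning
  X : ℕ → ℕ
  X c = ∑[ S ⊆ n ] iverson (c + ∣ S ∩ B ∣ ≤ᵇ 2)
  distrib : ∀ p a b → 2 * p * (a + b) ≡ 2 * (p * a) + 2 * (p * b)
  distrib = solve-∀
sumSubsets-lowCount (suc n) (false ∷ B) c = begin
  2 ^ ∣ B ∣ * (X + X)             ≡⟨ double (2 ^ ∣ B ∣) X ⟩
  2 * (2 ^ ∣ B ∣ * X)             ≡⟨ cong (2 *_) (sumSubsets-lowCount n B c) ⟩
  2 * (2 ^ n * lowCount (∣ B ∣) c)  ≡⟨ *-assoc 2 (2 ^ n) _ ⟨
  2 * 2 ^ n * lowCount (∣ B ∣) c    ∎
  where
  open ≡-Reasoning
  X = ∑[ S ⊆ n ] iverson (c + ∣ S ∩ B ∣ ≤ᵇ 2)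
  double : ∀ p a → p * (a + a) ≡ 2 * (p * a)
  double = solve-∀

-- The exponential moment of the marked vertices

codegree : ∀ {n} → Graph n → Fin n → Fin n → ℕ
codegree H v u = ∣ N H v ∩ N H u ∣

codegree≡sum : ∀ {n} (H : Graph n) v u → codegree H v u ≡ sum (λ w → iverson (adj H v w) * iverson (adj H w u))
codegree≡sum H v u = trans (∣p∩q∣≡sum (N H v) (N H u)) (sum-cong-≗ (λ w → begin
  iverson (lookup (N H v) w ∧ lookup (N H u) w)  ≡⟨ cong₂ (λ a b → iverson (a ∧ b)) (lookup∘tabulate (adj H v) w) (lookup∘tabulate (adj H u) w) ⟩
  iverson (adj H v w ∧ adj H u w)                ≡⟨ iverson-∧ (adj H v w) (adj H u w) ⟩
  iverson (adj H v w) * iverson (adj H u w)      ≡⟨ cong (λ b → iverson (adj H v w) * iverson b) (Graph.sym H u w) ⟩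
  iverson (adj H v w) * iverson (adj H w u)      ∎))
  where open ≡-Reasoning

-- Summing codegree H v over all u counts the walks v – w – u.
sum-codegree≤ : ∀ {n} (H : Graph n) {h} → (∀ v → deg H v ≤ h) → ∀ v → sum (codegree H v) ≤ h * h
sum-codegree≤ H {h} deg≤h v = begin
  sum (codegree H v)                                          ≡⟨ sum-cong-≗ (codegree≡sum H v) ⟩
  sum (λ u → sum (λ w → iverson (adj H v w) * iverson (adj H w u))) ≡⟨ sum-comm (λ u w → iverson (adj H v w) * iverson (adj H w u)) ⟩
  sum (λ w → sum (λ u → iverson (adj H v w) * iverson (adj H w u))) ≡⟨ sum-cong-≗ (λ w → sym (*-distribˡ-sum (iverson (adj H v w)) (iverson ∘ adj H w))) ⟩
  sum (λ w → iverson (adj H v w) * sum (iverson ∘ adj H w))   ≡⟨ sum-cong-≗ (λ w → cong (iverson (adj H v w) *_) (∣tabulate∣≡sum (adj H w))) ⟨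
  sum (λ w → iverson (adj H v w) * deg H w)                   ≤⟨ sum-mono-≤ (λ w → *-monoʳ-≤ (iverson (adj H v w)) (deg≤h w)) ⟩
  sum (λ w → iverson (adj H v w) * h)                         ≡⟨ sum-cong-≗ (λ w → *-comm (iverson (adj H v w)) h) ⟩
  sum (λ w → h * iverson (adj H v w))                         ≡⟨ *-distribˡ-sum h (iverson ∘ adj H v) ⟨
  h * sum (iverson ∘ adj H v)                                 ≡⟨ cong (h *_) (∣tabulate∣≡sum (adj H v)) ⟨
  h * deg H v                                                 ≤⟨ *-monoʳ-≤ h (deg≤h v) ⟩
  h * h                                                       ∎
  where open ≤-Reasoning

factor-ratio : ∀ M k {i i′} → i ≤ 1 → (k ≡ 0 → i ≡ i′) → M ^ k * (M + i) ≤ suc M ^ k * (M + i′)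
factor-ratio M zero    _   i≡i′ rewrite i≡i′ refl = ≤-refl
factor-ratio M (suc k) {i} {i′} i≤1 _ = begin
  M * M ^ k * (M + i)        ≤⟨ *-monoʳ-≤ (M * M ^ k) (+-monoʳ-≤ M i≤1) ⟩
  M * M ^ k * (M + 1)        ≡⟨ regroup M (M ^ k) ⟩
  M ^ k * M * suc M          ≤⟨ *-monoˡ-≤ (suc M) (*-mono-≤ (^-monoˡ-≤ k (n≤1+n M)) (m≤m+n M i′)) ⟩
  suc M ^ k * (M + i′) * suc M ≡⟨ regroup′ (suc M) (suc M ^ k) (M + i′) ⟩
  suc M * suc M ^ k * (M + i′) ∎
  where
  open ≤-Reasoning
  regroup : ∀ M p → M * p * (M + 1) ≡ p * M * suc M
  regroup = solve-∀
  regroup′ : ∀ a p x → p * x * a ≡ a * p * x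
  regroup′ = solve-∀

module Chernoff {n} (H : Graph n) (ℓ : ℕ) (14≤ℓ : 14 ≤ ℓ) (M C : ℕ) where

  high : Fin n → Bool
  high v = not (deg H v <ᵇ ℓ)

  marked : Subset n → Fin n → ℕ
  marked S u = iverson (high u ∧ (dS H S u ≤ᵇ 2))

  marks : Subset n → ℕ
  marks S = sum (marked S)

  weight : ∀ {m} → (Fin m → Fin n) → Subset n → ℕ
  weight {zero}  e S = 1
  weight {suc m} e S = (M + marked S (e zero)) * weight (e ∘ suc) S

  β α : ℕ
  β = 2 ^ 14 * M ^ C
  α = β * M + 106 * suc M ^ C

  marked-resample : ∀ v u S T → codegree H v u ≡ 0 → marked S u ≡ marked (resample (N H v) S T) u
  marked-resample v u S T N[v]∩N[u]≡∅ =
    cong (λ X → iverson (high u ∧ (∣ X ∣ ≤ᵇ 2))) (sym (resample-disjoint (N H v) (N H u) S T N[v]∩N[u]≡∅))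

  weight-resample : ∀ {m} (e : Fin m → Fin n) v S T →
    M ^ sum (codegree H v ∘ e) * weight e S ≤ suc M ^ sum (codegree H v ∘ e) * weight e (resample (N H v) S T)
  weight-resample {zero}  e v S T = ≤-refl
  weight-resample {suc m} e v S T = begin
    M ^ (k + r) * ((M + marked S u) * weight (e ∘ suc) S)
      ≡⟨ regroup M k r (M + marked S u) (weight (e ∘ suc) S) ⟩
    (M ^ k * (M + marked S u)) * (M ^ r * weight (e ∘ suc) S)
      ≤⟨ *-mono-≤ (factor-ratio M k (iverson≤1 _) (marked-resample v u S T)) (weight-resample (e ∘ suc) v S T) ⟩
    (suc M ^ k * (M + marked S′ u)) * (suc M ^ r * weight (e ∘ suc) S′)
      ≡⟨ regroup (suc M) k r (M + marked S′ u) (weight (e ∘ suc) S′) ⟨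
    suc M ^ (k + r) * ((M + marked S′ u) * weight (e ∘ suc) S′)
      ∎
    where
    open ≤-Reasoning
    u = e zero
    k = codegree H v u
    r = sum (codegree H v ∘ e ∘ suc)
    S′ = resample (N H v) S T
    interchange : ∀ a b x y → a * b * (x * y) ≡ (a * x) * (b * y)
    interchange = solve-∀
    regroup : ∀ b k r x y → b ^ (k + r) * (x * y) ≡ (b ^ k * x) * (b ^ r * y)
    regroup b k r x y = trans (cong (_* (x * y)) (^-distribˡ-+-* b k r)) (interchange (b ^ k) (b ^ r) x y)

  high⇒14≤deg : ∀ v → high v ≡ true → 14 ≤ deg H v
  high⇒14≤deg v high-v with deg H v <ᵇ ℓ in d<ℓ
  high⇒14≤deg v ()     | true
  high⇒14≤deg v _      | false = ≤-trans 14≤ℓ (≮⇒≥ (λ d<ℓ′ → subst T d<ℓ (<⇒<ᵇ d<ℓ′)))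

  -- P[v ∈ L(S)] ≤ 106 / 2^14, and resampling S on N(v) decorrelates this event from weight e.
  inL-weight-bound : ∀ {m} (e : Fin m → Fin n) v → high v ≡ true → sum (codegree H v ∘ e) ≤ C →
    β * ∑[ S ⊆ n ] (iverson (dS H S v ≤ᵇ 2) * weight e S) ≤ 106 * suc M ^ C * sumSubsets n (weight e)
  inL-weight-bound e v high-v codeg≤C =
    *-cancelˡ-≤ (2 ^ d) {{m^n≢0 2 d}} (*-cancelˡ-≤ (2 ^ n) {{m^n≢0 2 n}} (begin
      2 ^ n * (2 ^ d * (β * X))                    ≡⟨ regroup₁ (2 ^ n) (2 ^ d) (2 ^ 14) (M ^ C) X ⟩
      2 ^ d * 2 ^ 14 * (2 ^ n * M ^ C * X)         ≤⟨ *-monoʳ-≤ (2 ^ d * 2 ^ 14) (decorrelation n (N H v) (M ^ C) (suc M ^ C) (weight e) inL inL-local resample-bound) ⟩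
      2 ^ d * 2 ^ 14 * (suc M ^ C * (G * Y))       ≡⟨ regroup₂ (2 ^ d) (2 ^ 14) (suc M ^ C) G Y ⟩
      suc M ^ C * Y * 2 ^ 14 * (2 ^ d * G)         ≡⟨ cong (suc M ^ C * Y * 2 ^ 14 *_) (sumSubsets-lowCount n (N H v) 0) ⟩
      suc M ^ C * Y * 2 ^ 14 * (2 ^ n * lowCount d 0) ≡⟨ regroup₃ (suc M ^ C) Y (2 ^ 14) (2 ^ n) (lowCount d 0) ⟩
      suc M ^ C * Y * 2 ^ n * (2 ^ 14 * lowCount d 0) ≤⟨ *-monoʳ-≤ (suc M ^ C * Y * 2 ^ n) (lowCount-bound 14≤d) ⟩
      suc M ^ C * Y * 2 ^ n * (106 * 2 ^ d)        ≡⟨ regroup₄ (suc M ^ C) Y (2 ^ n) (2 ^ d) ⟩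
      2 ^ n * (2 ^ d * (106 * suc M ^ C * Y))      ∎))
    where
    open ≤-Reasoning
    d = deg H v
    inL : Subset n → ℕ
    inL S = iverson (dS H S v ≤ᵇ 2)
    X = ∑[ S ⊆ n ] (inL S * weight e S)
    Y = sumSubsets n (weight e)
    G = sumSubsets n inL
    inL-local : ∀ S T → inL (resample (N H v) T S) ≡ inL S
    inL-local S T = cong (λ X → iverson (∣ X ∣ ≤ᵇ 2)) (resample-∩ (N H v) S T)
    resample-bound : ∀ S T → M ^ C * weight e S ≤ suc M ^ C * weight e (resample (N H v) S T)
    resample-bound S T = ^-exponent-raise (weight e S) _ (n≤1+n M) codeg≤C (weight-resample e v S T)
    14≤d : 14 ≤ d
    14≤d = high⇒14≤deg v high-v
    regroup₁ : ∀ a b c p x → a * (b * (c * p * x)) ≡ b * c * (a * p * x)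
    regroup₁ = solve-∀
    regroup₂ : ∀ b c p g y → b * c * (p * (g * y)) ≡ p * y * c * (b * g)
    regroup₂ = solve-∀
    regroup₃ : ∀ p y c a k → p * y * c * (a * k) ≡ p * y * a * (c * k)
    regroup₃ = solve-∀
    regroup₄ : ∀ p y a b → p * y * a * (106 * b) ≡ a * (b * (106 * p * y))
    regroup₄ = solve-∀

  -- Peel off the factor M + marked S u of the first vertex u; its marked part is bounded by inL-weight-bound.
  chernoff : ∀ {m} (e : Fin m → Fin n) → (∀ v → sum (codegree H v ∘ e) ≤ C) →
    β ^ m * sumSubsets n (weight e) ≤ α ^ m * 2 ^ n
  chernoff {zero}  e _ = ≤-reflexive (trans (+-identityʳ _) (trans (sumSubsets-const n 1) (trans (*-identityʳ (2 ^ n)) (sym (*-identityˡ (2 ^ n))))))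
  chernoff {suc m} e codeg≤C = begin
    β * β ^ m * sumSubsets n (weight e)        ≡⟨ cong (β * β ^ m *_) split ⟩
    β * β ^ m * (M * Y + X)                    ≡⟨ regroup₁ β (β ^ m) M Y X ⟩
    β ^ m * (β * M * Y + β * X)                ≤⟨ *-monoʳ-≤ (β ^ m) (+-monoʳ-≤ (β * M * Y) marked-part) ⟩
    β ^ m * (β * M * Y + 106 * suc M ^ C * Y)  ≡⟨ regroup₂ (β ^ m) (β * M) (106 * suc M ^ C) Y ⟩
    α * (β ^ m * Y)                            ≤⟨ *-monoʳ-≤ α (chernoff (e ∘ suc) codeg′≤C) ⟩
    α * (α ^ m * 2 ^ n)                        ≡⟨ *-assoc α (α ^ m) (2 ^ n) ⟨
    α * α ^ m * 2 ^ n                          ∎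
    where
    open ≤-Reasoning
    u = e zero
    Y = sumSubsets n (weight (e ∘ suc))
    X = ∑[ S ⊆ n ] (marked S u * weight (e ∘ suc) S)
    codeg′≤C : ∀ v → sum (codegree H v ∘ e ∘ suc) ≤ C
    codeg′≤C v = ≤-trans (m≤n+m _ (codegree H v u)) (codeg≤C v)
    split : sumSubsets n (weight e) ≡ M * Y + X
    split = trans (sumSubsets-cong n (λ S → *-distribʳ-+ (weight (e ∘ suc) S) M (marked S u)))
            (trans (sumSubsets-distrib-+ n (λ S → M * weight (e ∘ suc) S) (λ S → marked S u * weight (e ∘ suc) S))
                   (cong (_+ X) (*-distribˡ-sumSubsets n M (weight (e ∘ suc)))))
    marked-part : β * X ≤ 106 * suc M ^ C * Y
    marked-part with high u in high-u
    ... | true  = inL-weight-bound (e ∘ suc) u high-u (codeg′≤C u)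
    ... | false = ≤-trans (≤-reflexive (trans (cong (β *_) (trans (sumSubsets-const n 0) (*-zeroʳ (2 ^ n)))) (*-zeroʳ β))) z≤n
    regroup₁ : ∀ b p m y x → b * p * (m * y + x) ≡ p * (b * m * y + b * x)
    regroup₁ = solve-∀
    regroup₂ : ∀ p a k y → p * (a * y + k * y) ≡ (a + k) * (p * y)
    regroup₂ = solve-∀

  weight-closed : ∀ {m} (e : Fin m → Fin n) S →
    M ^ sum (marked S ∘ e) * weight e S ≡ suc M ^ sum (marked S ∘ e) * M ^ m
  weight-closed {zero}  e S = refl
  weight-closed {suc m} e S = begin
    M ^ (i + r) * ((M + i) * weight (e ∘ suc) S)          ≡⟨ regroup M i r (M + i) (weight (e ∘ suc) S) ⟩
    (M ^ i * (M + i)) * (M ^ r * weight (e ∘ suc) S)      ≡⟨ cong₂ _*_ (one-factor (high (e zero) ∧ (dS H S (e zero) ≤ᵇ 2))) (weight-closed (e ∘ suc) S) ⟩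
    (suc M ^ i * M) * (suc M ^ r * M ^ m)                 ≡⟨ interchange (suc M ^ i) M (suc M ^ r) (M ^ m) ⟩
    (suc M ^ i * suc M ^ r) * (M * M ^ m)                 ≡⟨ cong (_* M ^ suc m) (^-distribˡ-+-* (suc M) i r) ⟨
    suc M ^ (i + r) * M ^ suc m                           ∎
    where
    open ≡-Reasoning
    i = marked S (e zero)
    r = sum (marked S ∘ e ∘ suc)
    interchange : ∀ a b x y → a * b * (x * y) ≡ (a * x) * (b * y)
    interchange = solve-∀
    regroup : ∀ b i r x y → b ^ (i + r) * (x * y) ≡ (b ^ i * x) * (b ^ r * y)
    regroup b i r x y = trans (cong (_* (x * y)) (^-distribˡ-+-* b i r)) (interchange (b ^ i) (b ^ r) x y)
    marked-factor : ∀ M → M * 1 * (M + 1) ≡ suc M * 1 * M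
    marked-factor = solve-∀
    one-factor : ∀ x → M ^ iverson x * (M + iverson x) ≡ suc M ^ iverson x * M
    one-factor true  = marked-factor M
    one-factor false = trans (*-identityˡ (M + 0)) (trans (+-identityʳ M) (sym (*-identityˡ M)))

  markov : ∀ (p : Subset n → Bool) {a} → .{{NonZero M}} → (∀ S → T (p S) → a ≤ marks S) →
    length (filterᵇ p (allSubsets n)) * (suc M ^ a * M ^ n) ≤ M ^ a * sumSubsets n (weight id)
  markov p {a} p⇒a≤marks = begin
    length (filterᵇ p (allSubsets n)) * (suc M ^ a * M ^ n)   ≤⟨ length-filter*≤sum p (λ S → M ^ a * weight id S) (allSubsets n) weight-lower-bound ⟩
    sumˡ (map (λ S → M ^ a * weight id S) (allSubsets n))     ≡⟨ sumˡ-allSubsets n (λ S → M ^ a * weight id S) ⟩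
    ∑[ S ⊆ n ] (M ^ a * weight id S)                          ≡⟨ *-distribˡ-sumSubsets n (M ^ a) (weight id) ⟩
    M ^ a * sumSubsets n (weight id)                          ∎
    where
    open ≤-Reasoning
    weight-lower-bound : ∀ S → T (p S) → suc M ^ a * M ^ n ≤ M ^ a * weight id S
    weight-lower-bound S pS = ^-exponent-lower (M ^ n) (weight id S) (n≤1+n M) (p⇒a≤marks S pS)
                                               (≤-reflexive (sym (weight-closed id S)))

  ∣L∣≤marks+lowDegCount : ∀ S → ∣ L H S ∣ ≤ marks S + lowDegCount H ℓ
  ∣L∣≤marks+lowDegCount S = begin
    ∣ L H S ∣                                                ≡⟨ ∣tabulate∣≡sum (λ u → dS H S u ≤ᵇ 2) ⟩
    sum (λ u → iverson (dS H S u ≤ᵇ 2))                      ≤⟨ sum-mono-≤ split ⟩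
    sum (λ u → marked S u + iverson (deg H u <ᵇ ℓ))          ≡⟨ sum-distrib-+ (marked S) (λ u → iverson (deg H u <ᵇ ℓ)) ⟩
    marks S + sum (λ u → iverson (deg H u <ᵇ ℓ))             ≡⟨ cong (marks S +_) (∣tabulate∣≡sum (λ u → deg H u <ᵇ ℓ)) ⟨
    marks S + lowDegCount H ℓ                                ∎
    where
    open ≤-Reasoning
    split : ∀ u → iverson (dS H S u ≤ᵇ 2) ≤ marked S u + iverson (deg H u <ᵇ ℓ)
    split u with deg H u <ᵇ ℓ
    ... | true  = iverson≤1 _
    ... | false = m≤m+n _ 0

m≤[1+k]*[m+k]/[1+k] : ∀ m k → m ≤ suc k * ((m + k) / suc k)
m≤[1+k]*[m+k]/[1+k] m k = +-cancelˡ-≤ k m _ (begin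
  k + m                                        ≡⟨ +-comm k m ⟩
  m + k                                        ≡⟨ m≡m%n+[m/n]*n (m + k) (suc k) ⟩
  (m + k) % suc k + (m + k) / suc k * suc k    ≤⟨ +-monoˡ-≤ _ (≤-pred (m%n<n (m + k) (suc k))) ⟩
  k + (m + k) / suc k * suc k                  ≡⟨ cong (k +_) (*-comm ((m + k) / suc k) (suc k)) ⟩
  k + suc k * ((m + k) / suc k)                ∎)
  where open ≤-Reasoning

[m+k]/[1+k]-least : ∀ m k x → m ≤ suc k * x → (m + k) / suc k ≤ x
[m+k]/[1+k]-least m k x m≤[1+k]x = ≤-pred (m<n*o⇒m/o<n {m + k} {suc x} {suc k} (begin-strict
  m + k              ≤⟨ +-monoˡ-≤ k m≤[1+k]x ⟩
  suc k * x + k      <⟨ n<1+n _ ⟩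
  suc (suc k * x + k) ≡⟨ regroup k x ⟩
  suc x * suc k      ∎))
  where
  open ≤-Reasoning
  regroup : ∀ k x → suc (suc k * x + k) ≡ suc x * suc k
  regroup = solve-∀

[1+1/4c]^c≤4/3 : ∀ c → 3 * suc (4 * c) ^ c ≤ 4 * (4 * c) ^ c
[1+1/4c]^c≤4/3 zero      = n≤1+n 3
[1+1/4c]^c≤4/3 c@(suc _) = *-cancelˡ-≤ c (begin
  c * (3 * suc (4 * c) ^ c)  ≡⟨ regroup₁ c (suc (4 * c) ^ c) ⟩
  suc (4 * c) ^ c * (3 * c)  ≤⟨ reverse-bernoulli c (3 * c) (c+3c≡4c c) ⟩
  4 * c * (4 * c) ^ c        ≡⟨ regroup₂ c ((4 * c) ^ c) ⟩
  c * (4 * (4 * c) ^ c)      ∎)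
  where
  open ≤-Reasoning
  c+3c≡4c : ∀ c → c + 3 * c ≡ 4 * c
  c+3c≡4c = solve-∀
  regroup₁ : ∀ c p → c * (3 * p) ≡ p * (3 * c)
  regroup₁ = solve-∀
  regroup₂ : ∀ c p → 4 * c * p ≡ c * (4 * p)
  regroup₂ = solve-∀

-- 8480 = 60 · 106 · 4/3.
60[KAM+106B]≤KA[60M+1] : ∀ K A B M → 8480 ≤ K → 3 * B ≤ 4 * A → 60 * (K * A * M + 106 * B) ≤ K * A * suc (60 * M)
60[KAM+106B]≤KA[60M+1] K A B M 8480≤K 3B≤4A = begin
  60 * (K * A * M + 106 * B)      ≡⟨ regroup₁ K A B M ⟩
  60 * (K * A * M) + 2120 * (3 * B) ≤⟨ +-monoʳ-≤ (60 * (K * A * M)) (*-monoʳ-≤ 2120 3B≤4A) ⟩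
  60 * (K * A * M) + 2120 * (4 * A) ≡⟨ cong (60 * (K * A * M) +_) (regroup₂ A) ⟩
  60 * (K * A * M) + 8480 * A     ≤⟨ +-monoʳ-≤ (60 * (K * A * M)) (*-monoˡ-≤ A 8480≤K) ⟩
  60 * (K * A * M) + K * A        ≡⟨ regroup₃ K A M ⟩
  K * A * suc (60 * M)            ∎
  where
  open ≤-Reasoning
  regroup₁ : ∀ K A B M → 60 * (K * A * M + 106 * B) ≡ 60 * (K * A * M) + 2120 * (3 * B)
  regroup₁ = solve-∀
  regroup₂ : ∀ A → 2120 * (4 * A) ≡ 8480 * A
  regroup₂ = solve-∀
  regroup₃ : ∀ K A M → 60 * (K * A * M) + K * A ≡ K * A * suc (60 * M)
  regroup₃ = solve-∀

-- With q = 3M, U = (M + 1) (60M)^30 and V = M (60M + 1)^30 this reads (q + 1) V ≤ q U.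
per-vertex-ratio : ∀ M → 3 ≤ M → suc (3 * M) * (M * suc (60 * M) ^ 30) ≤ 3 * M * (suc M * (60 * M) ^ 30)
per-vertex-ratio m 3≤m = subst P (m+[n∸m]≡n 3≤m) (from-3 (m ∸ 3))
  where
  P : ℕ → Set
  P M = suc (3 * M) * (M * suc (60 * M) ^ 30) ≤ 3 * M * (suc M * (60 * M) ^ 30)
  30+d≡60M : ∀ t → 30 + (150 + 60 * t) ≡ 60 * (3 + t)
  30+d≡60M = solve-∀
  polynomial : ∀ t → suc (3 * (3 + t)) * (3 + t) * (60 * (3 + t)) + (3 + t) * (30 * t)
                   ≡ 3 * (3 + t) * suc (3 + t) * (150 + 60 * t)
  polynomial = solve-∀
  regroup₁ : ∀ d a m p → d * (a * (m * p)) ≡ a * m * (p * d)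
  regroup₁ = solve-∀
  regroup₂ : ∀ a b d p → a * b * d * p ≡ d * (a * (b * p))
  regroup₂ = solve-∀
  polynomial-step : ∀ t {A B} → A * (150 + 60 * t) ≤ 60 * (3 + t) * B →
                    suc (3 * (3 + t)) * ((3 + t) * A) ≤ 3 * (3 + t) * (suc (3 + t) * B)
  polynomial-step t {A} {B} Ad≤60MB = *-cancelˡ-≤ d (begin
    d * (suc (3 * M) * (M * A))    ≡⟨ regroup₁ d (suc (3 * M)) M A ⟩
    suc (3 * M) * M * (A * d)      ≤⟨ *-monoʳ-≤ (suc (3 * M) * M) Ad≤60MB ⟩
    suc (3 * M) * M * (60 * M * B) ≡⟨ *-assoc (suc (3 * M) * M) (60 * M) B ⟨
    suc (3 * M) * M * (60 * M) * B ≤⟨ *-monoˡ-≤ B (≤-trans (m≤m+n (suc (3 * M) * M * (60 * M)) (M * (30 * t))) (≤-reflexive (polynomial t))) ⟩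
    3 * M * suc M * d * B          ≡⟨ regroup₂ (3 * M) (suc M) d B ⟩
    d * (3 * M * (suc M * B))      ∎)
    where
    open ≤-Reasoning
    M = 3 + t
    d = 150 + 60 * t
  -- Explicit instantiations: unification would unfold the 30th powers.
  from-3 : ∀ t → P (3 + t)
  from-3 t = polynomial-step t {suc (60 * (3 + t)) ^ 30} {(60 * (3 + t)) ^ 30}
                             (reverse-bernoulli 30 (150 + 60 * t) {60 * (3 + t)} (30+d≡60M t))

-- Counting the sets S with large L(S)

module Counting {n} (h : ℕ) .{{_ : NonZero h}} (ℓ : ℕ) (14≤ℓ : 14 ≤ ℓ) (H : Graph n)
                (deg≤h : ∀ v → deg H v ≤ h) (few-low : 60 * lowDegCount H ℓ ≤ n) where

  C M a j c : ℕ
  C = h * h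
  M = 4 * C
  a = (n + 29) / 30
  j = 60 * h ^ 4
  c = bigLCount H

  instance
    C≢0 : NonZero C
    C≢0 = m*n≢0 h h
    M≢0 : NonZero M
    M≢0 = m*n≢0 4 C

  open Chernoff H ℓ 14≤ℓ M C

  a≤marks : ∀ S → T (n ≤ᵇ 20 * ∣ L H S ∣) → a ≤ marks S
  a≤marks S n≤20∣L∣ = [m+k]/[1+k]-least n 29 (marks S) (*-cancelˡ-≤ 2 (+-cancelʳ-≤ n (2 * n) (2 * (30 * marks S)) (begin
    2 * n + n                                     ≡⟨ 2n+n≡3n n ⟩
    3 * n                                         ≤⟨ *-monoʳ-≤ 3 (≤ᵇ⇒≤ n (20 * ∣ L H S ∣) n≤20∣L∣) ⟩
    3 * (20 * ∣ L H S ∣)                          ≤⟨ *-monoʳ-≤ 3 (*-monoʳ-≤ 20 (∣L∣≤marks+lowDegCount S)) ⟩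
    3 * (20 * (marks S + lowDegCount H ℓ))        ≡⟨ expand (marks S) (lowDegCount H ℓ) ⟩
    2 * (30 * marks S) + 60 * lowDegCount H ℓ     ≤⟨ +-monoʳ-≤ (2 * (30 * marks S)) few-low ⟩
    2 * (30 * marks S) + n                        ∎)))
    where
    open ≤-Reasoning
    2n+n≡3n : ∀ n → 2 * n + n ≡ 3 * n
    2n+n≡3n = solve-∀
    expand : ∀ x l → 3 * (20 * (x + l)) ≡ 2 * (30 * x) + 60 * l
    expand = solve-∀

  60α≤β[60M+1] : 60 * α ≤ β * suc (60 * M)
  60α≤β[60M+1] = 60[KAM+106B]≤KA[60M+1] (2 ^ 14) (M ^ C) (suc M ^ C) M (m≤m+n 8480 7904) ([1+1/4c]^c≤4/3 C)

  counting : suc M ^ a * (c * (60 * M) ^ n) ≤ M ^ a * (2 ^ n * suc (60 * M) ^ n)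
  counting = *-cancelˡ-≤ (β ^ n) {{m^n≢0 β n {{m*n≢0 (2 ^ 14) (M ^ C) {{m^n≢0 2 14}} {{m^n≢0 M C}}}}}} (begin
    β ^ n * (suc M ^ a * (c * (60 * M) ^ n))            ≡⟨ cong (λ z → β ^ n * (suc M ^ a * (c * z))) (^-distribʳ-* 60 M n) ⟩
    β ^ n * (suc M ^ a * (c * (60 ^ n * M ^ n)))        ≡⟨ regroup₁ (β ^ n) (suc M ^ a) c (60 ^ n) (M ^ n) ⟩
    c * (suc M ^ a * M ^ n) * (60 ^ n * β ^ n)          ≤⟨ *-monoˡ-≤ (60 ^ n * β ^ n) (markov (λ S → n ≤ᵇ 20 * ∣ L H S ∣) a≤marks) ⟩
    M ^ a * sumSubsets n (weight id) * (60 ^ n * β ^ n) ≡⟨ regroup₂ (M ^ a) (sumSubsets n (weight id)) (60 ^ n) (β ^ n) ⟩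
    M ^ a * 60 ^ n * (β ^ n * sumSubsets n (weight id)) ≤⟨ *-monoʳ-≤ (M ^ a * 60 ^ n) (chernoff id (sum-codegree≤ H deg≤h)) ⟩
    M ^ a * 60 ^ n * (α ^ n * 2 ^ n)                    ≡⟨ regroup₃ (M ^ a) (60 ^ n) (α ^ n) (2 ^ n) ⟩
    M ^ a * 2 ^ n * (60 ^ n * α ^ n)                    ≡⟨ cong (M ^ a * 2 ^ n *_) (^-distribʳ-* 60 α n) ⟨
    M ^ a * 2 ^ n * (60 * α) ^ n                        ≤⟨ *-monoʳ-≤ (M ^ a * 2 ^ n) (^-monoˡ-≤ n 60α≤β[60M+1]) ⟩
    M ^ a * 2 ^ n * (β * suc (60 * M)) ^ n              ≡⟨ cong (M ^ a * 2 ^ n *_) (^-distribʳ-* β (suc (60 * M)) n) ⟩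
    M ^ a * 2 ^ n * (β ^ n * suc (60 * M) ^ n)          ≡⟨ regroup₄ (M ^ a) (2 ^ n) (β ^ n) (suc (60 * M) ^ n) ⟩
    β ^ n * (M ^ a * (2 ^ n * suc (60 * M) ^ n))        ∎)
    where
    open ≤-Reasoning
    regroup₁ : ∀ b p c s m → b * (p * (c * (s * m))) ≡ c * (p * m) * (s * b)
    regroup₁ = solve-∀
    regroup₂ : ∀ q w s b → q * w * (s * b) ≡ q * s * (b * w)
    regroup₂ = solve-∀
    regroup₃ : ∀ q s a t → q * s * (a * t) ≡ q * t * (s * a)
    regroup₃ = solve-∀
    regroup₄ : ∀ q t b r → q * t * (b * r) ≡ b * (q * (t * r))
    regroup₄ = solve-∀

  U V : ℕ
  U = suc M * (60 * M) ^ 30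
  V = M * suc (60 * M) ^ 30

  -- Raise to the 30th power and lower the exponent 30a of (M + 1)/M to n ≤ 30a.
  counting³⁰ : c ^ 30 * U ^ n ≤ (2 ^ n) ^ 30 * V ^ n
  counting³⁰ = subst₂ _≤_ (reshape (suc M) c (60 * M)) (reshape M (2 ^ n) (suc (60 * M)))
    (^-exponent-lower ((c * (60 * M) ^ n) ^ 30) ((2 ^ n * suc (60 * M) ^ n) ^ 30) (n≤1+n M) n≤a*30
      (subst₂ _≤_ (power (suc M) (c * (60 * M) ^ n)) (power M (2 ^ n * suc (60 * M) ^ n)) (^-monoˡ-≤ 30 counting)))
    where
    n≤a*30 : n ≤ a * 30
    n≤a*30 = subst (n ≤_) (*-comm 30 a) (m≤[1+k]*[m+k]/[1+k] n 29)
    power : ∀ p x → (p ^ a * x) ^ 30 ≡ p ^ (a * 30) * x ^ 30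
    power p x = trans (^-distribʳ-* (p ^ a) x 30) (cong (_* x ^ 30) (^-*-assoc p a 30))
    reshape : ∀ p x t → p ^ n * (x * t ^ n) ^ 30 ≡ x ^ 30 * (p * t ^ 30) ^ n
    reshape p x t = begin
      p ^ n * (x * t ^ n) ^ 30        ≡⟨ cong (p ^ n *_) (^-distribʳ-* x (t ^ n) 30) ⟩
      p ^ n * (x ^ 30 * (t ^ n) ^ 30) ≡⟨ cong (λ z → p ^ n * (x ^ 30 * z)) (trans (^-*-assoc t n 30) (cong (t ^_) (*-comm n 30))) ⟩
      p ^ n * (x ^ 30 * t ^ (30 * n)) ≡⟨ cong (λ z → p ^ n * (x ^ 30 * z)) (^-*-assoc t 30 n) ⟨
      p ^ n * (x ^ 30 * (t ^ 30) ^ n) ≡⟨ rotate (p ^ n) (x ^ 30) ((t ^ 30) ^ n) ⟩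
      x ^ 30 * (p ^ n * (t ^ 30) ^ n) ≡⟨ cong (x ^ 30 *_) (^-distribʳ-* p (t ^ 30) n) ⟨
      x ^ 30 * (p * t ^ 30) ^ n       ∎
      where
      open ≡-Reasoning
      rotate : ∀ a b c → a * (b * c) ≡ b * (a * c)
      rotate = solve-∀

  3V^j≤U^j : 3 * V ^ j ≤ U ^ j
  3V^j≤U^j = ratio-power {3 * M} {U} {V} {3} j {{m*n≢0 3 M}} (thrice-^≤suc-^ (3 * M) {{m*n≢0 3 M}} 6M≤j) (per-vertex-ratio M 3≤M)
    where
    3≤M : 3 ≤ M
    3≤M = ≤-trans (n≤1+n 3) (*-monoʳ-≤ 4 (>-nonZero⁻¹ C))
    6M≤j : 2 * (3 * M) ≤ j
    6M≤j = begin
      2 * (3 * (4 * C))  ≡⟨ 24C (h * h) ⟩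
      24 * C             ≤⟨ *-monoˡ-≤ C (m≤m+n 24 36) ⟩
      60 * C             ≤⟨ *-monoʳ-≤ 60 (m≤m*n C C) ⟩
      60 * (C * C)       ≡⟨ cong (60 *_) (h⁴ h) ⟩
      60 * h ^ 4         ∎
      where
      open ≤-Reasoning
      24C : ∀ C → 2 * (3 * (4 * C)) ≡ 24 * C
      24C = solve-∀
      h⁴ : ∀ h → h * h * (h * h) ≡ h * (h * (h * (h * 1)))
      h⁴ = solve-∀

  bigLCount-bound : c ^ (1800 * h ^ 4) * 3 ^ n ≤ (2 ^ n) ^ (1800 * h ^ 4)
  bigLCount-bound = subst₂ (λ x y → x * 3 ^ n ≤ y) (trans (^-*-assoc c 30 j) (cong (c ^_) 30j≡m)) (trans (^-*-assoc (2 ^ n) 30 j) (cong ((2 ^ n) ^_) 30j≡m))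
    (^-ratio-transfer {c ^ 30} {(2 ^ n) ^ 30} {3} {U} {V} n j {{m*n≢0 M (suc (60 * M) ^ 30) {{M≢0}} {{m^n≢0 (suc (60 * M)) 30}}}} counting³⁰ 3V^j≤U^j)
    where
    30j≡m : 30 * j ≡ 1800 * h ^ 4
    30j≡m = sym (*-assoc 30 60 (h ^ 4))

lemma7 : (n h ℓ : ℕ) → 1 ≤ h → 14 ≤ ℓ → (H : Graph n) →
    (∀ v → deg H v ≤ h) →
    60 * lowDegCount H ℓ ≤ n →
    (bigLCount H ^ (1800 * h ^ 4)) ·e^ n ≤ ((h ^ 2 * 2 ^ n) ^ (1800 * h ^ 4))
lemma7 n h ℓ 1≤h 14≤ℓ H deg≤h few-low = ·e^≤-from-3^ (bigLCount H ^ m) n ((h ^ 2 * 2 ^ n) ^ m) (begin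
  bigLCount H ^ m * 3 ^ n  ≤⟨ bigLCount-bound ⟩
  (2 ^ n) ^ m              ≤⟨ ^-monoˡ-≤ m (m≤n*m (2 ^ n) (h ^ 2) {{m^n≢0 h 2}}) ⟩
  (h ^ 2 * 2 ^ n) ^ m      ∎)
  where
  open ≤-Reasoning
  instance
    h≢0 : NonZero h
    h≢0 = >-nonZero 1≤h
  open Counting h ℓ 14≤ℓ H deg≤h few-low
  m = 1800 * h ^ 4
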